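{- For all positive integers $k,N$, \[\frac{1}{k}\,G'_{1/[k]}(N)\le F'_k(N)\le k\,G'_{1/[k]}(N).\] In particular $\lim_{k\to\infty}\lim_{N\to\infty}\log G'_{1/[k]}(N)/\log N=1$ if and only if $\lim_{k\to\infty}\lim_{N\to\infty}\log F'_{k}(N)/\log N=1$.
   Context: Let $1/[k]=\{1/i:1\le i\le k\}$. A $U$-pattern with basepoint $x$ and nonzero scaling factor $r$ is $x+r\cdot U$. $G'_{1/[k]}(N)$ is the size of the smallest set of rational numbers that contains a $1/[k]$-pattern with basepoint $a$ for $N$ distinct integer values of $a$. $F'_k(N)$ is the size of the smallest set of integers containing a $k$-term arithmetic progression with common difference $d$ for $N$ distinct integer values of $d$. -}

module Defs where

open import Data.Nat using (ℕ; suc; _≤_; _*_)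
open import Data.Fin using (Fin; toℕ)
open import Data.Integer as ℤ using (ℤ; +_)
open import Data.Rational as ℚ using (ℚ; _/_; 0ℚ)
open import Data.List using (List; length)
open import Data.List.Membership.Propositional using (_∈_)
open import Data.List.Relation.Unary.All using (All)
open import Data.List.Relation.Unary.Unique.Propositional using (Unique)
open import Data.Product using (Σ; _×_; ∃)
open import Relation.Binary.PropositionalEquality using (_≡_; _≢_)

toℚ : ℤ → ℚ
toℚ a = a / 1

-- The finite set S ⊆ ℚ (a duplicate-free list) contains a 1/[k]-pattern
-- with basepoint a:  a + r·{1/1, …, 1/k} ⊆ S for some nonzero rational r.
HasHarmonicPattern : ℕ → List ℚ → ℤ → Set
HasHarmonicPattern k S a =
  Σ ℚ λ r → (r ≢ 0ℚ) × ((i : Fin k) → (toℚ a ℚ.+ r ℚ.* (+ 1 / suc (toℕ i))) ∈ S)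

HasAP : ℕ → List ℤ → ℤ → Set
HasAP k S d = Σ ℤ λ a → (i : Fin k) → (a ℤ.+ (+ toℕ i) ℤ.* d) ∈ S

GAdmissible : ℕ → ℕ → ℕ → Set
GAdmissible k N m =
  Σ (List ℚ) λ S → Unique S × length S ≡ m ×
  Σ (List ℤ) λ A → Unique A × length A ≡ N × All (HasHarmonicPattern k S) A

FAdmissible : ℕ → ℕ → ℕ → Set
FAdmissible k N m =
  Σ (List ℤ) λ S → Unique S × length S ≡ m ×
  Σ (List ℤ) λ D → Unique D × length D ≡ N ×
    All (λ d → d ≢ + 0) D × All (HasAP k S) D

IsLeast : (ℕ → Set) → ℕ → Set
IsLeast P m = P m × ((m' : ℕ) → P m' → m ≤ m')

IsG' : ℕ → ℕ → ℕ → Set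
IsG' k N = IsLeast (GAdmissible k N)

IsF' : ℕ → ℕ → ℕ → Set
IsF' k N = IsLeast (FAdmissible k N)

-- Both inequalities come from explicit constructions that enlarge a set by a
-- factor of at most k.  If T ⊆ ℤ contains b_d + i·d (i < k) for every d ∈ D,
-- choose c ∉ D − T; then S = {(t + c)/(i + 1) : t ∈ T, i < k} contains the
-- pattern d + r/(i + 1) with r = c − (d − b_d) ≠ 0, since
-- d + r/(i + 1) = (b_d + i·d + c)/(i + 1).  Conversely, if S ⊆ ℚ contains
-- a + r/(i + 1) for every a ∈ A, let L be a common denominator of S and choose
-- c ∉ −A; the integers (i + 1)·L·(x + c), x ∈ S, then contain the progression
-- of difference L(a + c) ≠ 0 starting at L(a + r + c), because
-- (i + 1)·L·(a + r/(i + 1) + c) = L(a + r + c) + i·L(a + c).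
-- Minimality of G' and F' turns each construction into one inequality.
{-# OPTIONS --safe #-}
module Submission where

open import Defs
open import Data.Nat using (ℕ; _≤_; _*_; NonZero)
open import Data.Product using (_×_)

open import Algebra.Bundles using (CommutativeRing; CommutativeSemiring)
import Algebra.Properties.CommutativeSemigroup as CommSemigroupProperties
open import Data.Empty using (⊥-elim)
open import Data.Fin as Fin using (Fin; toℕ)
open import Data.Integer as ℤ using (ℤ; +_; 0ℤ)
import Data.Integer.Properties as ℤP
open import Algebra.Properties.AbelianGroup ℤP.+-0-abelianGroup using () renaming (∙-cancelʳ to +-cancelʳ)
open import Data.Integer.Tactic.RingSolver using (solve-∀)
open import Data.List using (List; []; _∷_; _++_; length; map; allFin; cartesianProductWith; deduplicate)
import Data.List.Extrema ℤP.≤-totalOrder as ℤExtrema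
open import Data.List.Membership.Propositional using (_∈_; _∉_)
open import Data.List.Membership.Propositional.Properties
  using (∈-map⁺; ∈-allFin; ∈-cartesianProductWith⁺; ∈-deduplicate⁺)
import Data.List.Properties as ListP
open import Data.List.Relation.Unary.All as All using (All)
import Data.List.Relation.Unary.All.Properties as AllP
open import Data.List.Relation.Unary.Unique.Propositional using (Unique)
open import Data.List.Relation.Unary.Unique.DecPropositional.Properties using (deduplicate-!)
import Data.List.Relation.Unary.Unique.Propositional.Properties as UniqueP
open import Data.Nat as ℕ using (suc; zero)
open import Data.Nat.DivMod using (_/_; m*[n/m]≡n)
open import Data.Nat.Divisibility using (_∣_)
open import Data.Nat.ListAction using (product)
open import Data.Nat.ListAction.Properties using (∈⇒∣product; product≢0)
import Data.Nat.Properties as ℕP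
open import Data.Product using (∃; _,_; proj₁; proj₂)
open import Data.Rational as ℚ using (ℚ; 0ℚ; 1ℚ; toℚᵘ)
import Data.Rational.Properties as ℚP
open import Data.Rational.Solver using (module +-*-Solver)
open import Data.Rational.Unnormalised as ℚᵘ using (mkℚᵘ; *≡*) renaming (_≃_ to _≃ᵘ_)
import Data.Rational.Unnormalised.Properties as ℚᵘP
open import Data.Sum using (inj₁; inj₂)
open import Function using (id)
open import Level using (0ℓ)
open import Relation.Binary.Definitions using (DecidableEquality)
open import Relation.Binary.PropositionalEquality as ≡
  using (_≡_; _≢_; refl; cong; cong₂; subst; module ≡-Reasoning)

module _ {c ℓ} (R : CommutativeSemiring c ℓ) where
  open CommutativeSemiring R renaming (_*_ to _·_)
  open CommSemigroupProperties *-commutativeSemigroup using (xy∙z≈y∙xz; x∙yz≈y∙xz)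
  open import Relation.Binary.Reasoning.Setoid setoid

  a+q·u≈[n·a+q]·u : ∀ {n u} a q → n · u ≈ 1# → a + q · u ≈ (n · a + q) · u
  a+q·u≈[n·a+q]·u {n} {u} a q n·u≈1 = sym (begin
    (n · a + q) · u      ≈⟨ distribʳ u (n · a) q ⟩
    n · a · u + q · u    ≈⟨ +-congʳ (xy∙z≈y∙xz n a u) ⟩
    a · (n · u) + q · u  ≈⟨ +-congʳ (trans (*-congˡ n·u≈1) (*-identityʳ a)) ⟩
    a + q · u            ∎)

  n·[a+q·u]≈n·a+q : ∀ {n u} a q → n · u ≈ 1# → n · (a + q · u) ≈ n · a + q
  n·[a+q·u]≈n·a+q {n} {u} a q n·u≈1 = begin
    n · (a + q · u)      ≈⟨ distribˡ n a (q · u) ⟩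
    n · a + n · (q · u)  ≈⟨ +-congˡ (x∙yz≈y∙xz n q u) ⟩
    n · a + q · (n · u)  ≈⟨ +-congˡ (trans (*-congˡ n·u≈1) (*-identityʳ q)) ⟩
    n · a + q            ∎

toℚᵘ-toℚ : ∀ z → toℚᵘ (toℚ z) ≃ᵘ mkℚᵘ z 0
toℚᵘ-toℚ z = ℚP.toℚᵘ-fromℚᵘ (mkℚᵘ z 0)

toℚ-homo-+ : ∀ x y → toℚ (x ℤ.+ y) ≡ toℚ x ℚ.+ toℚ y
toℚ-homo-+ x y = ℚP.toℚᵘ-injective (begin
  toℚᵘ (toℚ (x ℤ.+ y))                   ≈⟨ toℚᵘ-toℚ (x ℤ.+ y) ⟩
  mkℚᵘ (x ℤ.+ y) 0                       ≈⟨ *≡* (identity x y) ⟩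
  mkℚᵘ x 0 ℚᵘ.+ mkℚᵘ y 0                 ≈⟨ ℚᵘP.+-cong (toℚᵘ-toℚ x) (toℚᵘ-toℚ y) ⟨
  toℚᵘ (toℚ x) ℚᵘ.+ toℚᵘ (toℚ y)         ≈⟨ ℚP.toℚᵘ-homo-+ (toℚ x) (toℚ y) ⟨
  toℚᵘ (toℚ x ℚ.+ toℚ y)                 ∎)
  where
  open ℚᵘP.≃-Reasoning
  identity : ∀ x y → (x ℤ.+ y) ℤ.* + 1 ≡ (x ℤ.* + 1 ℤ.+ y ℤ.* + 1) ℤ.* + 1
  identity = solve-∀

toℚ-homo-* : ∀ x y → toℚ (x ℤ.* y) ≡ toℚ x ℚ.* toℚ y
toℚ-homo-* x y = ℚP.toℚᵘ-injective (begin
  toℚᵘ (toℚ (x ℤ.* y))                   ≈⟨ toℚᵘ-toℚ (x ℤ.* y) ⟩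
  mkℚᵘ (x ℤ.* y) 0                       ≈⟨ *≡* refl ⟩
  mkℚᵘ x 0 ℚᵘ.* mkℚᵘ y 0                 ≈⟨ ℚᵘP.*-cong (toℚᵘ-toℚ x) (toℚᵘ-toℚ y) ⟨
  toℚᵘ (toℚ x) ℚᵘ.* toℚᵘ (toℚ y)         ≈⟨ ℚP.toℚᵘ-homo-* (toℚ x) (toℚ y) ⟨
  toℚᵘ (toℚ x ℚ.* toℚ y)                 ∎)
  where open ℚᵘP.≃-Reasoning

toℚ-injective : ∀ {x y} → toℚ x ≡ toℚ y → x ≡ y
toℚ-injective {x} {y} eq = ℤP.*-cancelʳ-≡ x y (+ 1) (ℚᵘP.drop-*≡* (begin
  mkℚᵘ x 0        ≈⟨ toℚᵘ-toℚ x ⟨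
  toℚᵘ (toℚ x)    ≡⟨ cong toℚᵘ eq ⟩
  toℚᵘ (toℚ y)    ≈⟨ toℚᵘ-toℚ y ⟩
  mkℚᵘ y 0        ∎))
  where open ℚᵘP.≃-Reasoning

1/[1+_] : ℕ → ℚ
1/[1+ n ] = + 1 ℚ./ suc n

toℚ-[1+n]*1/[1+n]≡1 : ∀ n → toℚ (+ suc n) ℚ.* 1/[1+ n ] ≡ 1ℚ
toℚ-[1+n]*1/[1+n]≡1 n = ℚP.toℚᵘ-injective (begin
  toℚᵘ (toℚ (+ suc n) ℚ.* 1/[1+ n ])        ≈⟨ ℚP.toℚᵘ-homo-* (toℚ (+ suc n)) 1/[1+ n ] ⟩
  toℚᵘ (toℚ (+ suc n)) ℚᵘ.* toℚᵘ 1/[1+ n ]  ≈⟨ ℚᵘP.*-cong (toℚᵘ-toℚ (+ suc n)) (ℚP.toℚᵘ-fromℚᵘ (mkℚᵘ (+ 1) n)) ⟩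
  mkℚᵘ (+ suc n) 0 ℚᵘ.* mkℚᵘ (+ 1) n        ≈⟨ *≡* cross ⟩
  ℚᵘ.1ℚᵘ                                     ∎)
  where
  open ℚᵘP.≃-Reasoning
  identity : ∀ m → (m ℤ.* + 1) ℤ.* + 1 ≡ + 1 ℤ.* (+ 1 ℤ.* m)
  identity = solve-∀
  cross : (+ suc n ℤ.* + 1) ℤ.* + 1 ≡ + 1 ℤ.* + (1 ℕ.* suc n)
  cross = ≡.trans (identity (+ suc n)) (cong (+ 1 ℤ.*_) (ℤP.pos-* 1 (suc n)))

clearDenominator : ℕ → ℚ → ℤ
clearDenominator L x = ℚ.↥ x ℤ.* + (L / ℚ.↧ₙ x)

toℚ-↥*n : ∀ x n → toℚ (ℚ.↥ x ℤ.* + n) ≡ toℚ (+ (ℚ.↧ₙ x ℕ.* n)) ℚ.* x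
toℚ-↥*n x@(ℚ.mkℚ p d-1 _) n = ℚP.toℚᵘ-injective (begin
  toℚᵘ (toℚ (p ℤ.* + n))               ≈⟨ toℚᵘ-toℚ (p ℤ.* + n) ⟩
  mkℚᵘ (p ℤ.* + n) 0                   ≈⟨ *≡* cross ⟩
  mkℚᵘ (+ m) 0 ℚᵘ.* toℚᵘ x             ≈⟨ ℚᵘP.*-cong (toℚᵘ-toℚ (+ m)) ℚᵘP.≃-refl ⟨
  toℚᵘ (toℚ (+ m)) ℚᵘ.* toℚᵘ x         ≈⟨ ℚP.toℚᵘ-homo-* (toℚ (+ m)) x ⟨
  toℚᵘ (toℚ (+ m) ℚ.* x)               ∎)
  where
  open ℚᵘP.≃-Reasoning
  m = suc d-1 ℕ.* n
  identity : ∀ p n d → (p ℤ.* n) ℤ.* (+ 1 ℤ.* d) ≡ (d ℤ.* n ℤ.* p) ℤ.* + 1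
  identity = solve-∀
  cross : (p ℤ.* + n) ℤ.* + (1 ℕ.* suc d-1) ≡ (+ m ℤ.* p) ℤ.* + 1
  cross = ≡.trans (cong ((p ℤ.* + n) ℤ.*_) (ℤP.pos-* 1 (suc d-1)))
           (≡.trans (identity p (+ n) (+ suc d-1))
             (cong (λ z → (z ℤ.* p) ℤ.* + 1) (≡.sym (ℤP.pos-* (suc d-1) n))))

toℚ-clearDenominator : ∀ {L} x → ℚ.↧ₙ x ∣ L → toℚ (clearDenominator L x) ≡ toℚ (+ L) ℚ.* x
toℚ-clearDenominator {L} x ↧x∣L =
  ≡.trans (toℚ-↥*n x (L / ℚ.↧ₙ x)) (cong (λ m → toℚ (+ m) ℚ.* x) (m*[n/m]≡n ↧x∣L))

∃-∉ : (zs : List ℤ) → ∃ λ c → c ∉ zs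
∃-∉ zs = ℤ.suc m , λ 1+m∈zs →
  ℤP.<-irrefl refl (ℤP.suc[i]≤j⇒i<j (All.lookup (ℤExtrema.xs≤max 0ℤ zs) 1+m∈zs))
  where
  m : ℤ
  m = ℤExtrema.max 0ℤ zs

length-cartesianProductWith : ∀ {A B C : Set} (f : A → B → C) xs ys →
  length (cartesianProductWith f xs ys) ≡ length xs ℕ.* length ys
length-cartesianProductWith f []       ys = refl
length-cartesianProductWith f (x ∷ xs) ys = begin
  length (map (f x) ys ++ cartesianProductWith f xs ys)
    ≡⟨ ListP.length-++ (map (f x) ys) ⟩
  length (map (f x) ys) ℕ.+ length (cartesianProductWith f xs ys)
    ≡⟨ cong₂ ℕ._+_ (ListP.length-map (f x) ys) (length-cartesianProductWith f xs ys) ⟩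
  length ys ℕ.+ length xs ℕ.* length ys
    ∎
  where open ≡-Reasoning

module _ {A B : Set} (_≟_ : DecidableEquality B) {k} (f : A → Fin k → B) where

  table : List A → List B
  table xs = cartesianProductWith f xs (allFin k)

  image : List A → List B
  image xs = deduplicate _≟_ (table xs)

  image-unique : ∀ xs → Unique (image xs)
  image-unique xs = deduplicate-! _≟_ (table xs)

  length-image : ∀ xs → length (image xs) ≤ k ℕ.* length xs
  length-image xs = begin
    length (image xs)                              ≤⟨ ListP.length-deduplicate _≟_ (table xs) ⟩
    length (table xs)                              ≡⟨ length-cartesianProductWith f xs (allFin k) ⟩
    length xs ℕ.* length (allFin k)                ≡⟨ cong (length xs ℕ.*_) (ListP.length-tabulate id) ⟩
    length xs ℕ.* k                                ≡⟨ ℕP.*-comm (length xs) k ⟩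
    k ℕ.* length xs                                ∎
    where open ℕP.≤-Reasoning

  ∈-image : ∀ {x xs} → x ∈ xs → ∀ i → f x i ∈ image xs
  ∈-image x∈xs i = ∈-deduplicate⁺ _≟_ (∈-cartesianProductWith⁺ f x∈xs (∈-allFin i))

ℚ-commutativeSemiring : CommutativeSemiring 0ℓ 0ℓ
ℚ-commutativeSemiring = CommutativeRing.commutativeSemiring ℚP.+-*-commutativeRing

toℚ-AP-term≡harmonic-term : ∀ b c d n →
  toℚ ((b ℤ.+ + n ℤ.* d) ℤ.+ c) ℚ.* 1/[1+ n ] ≡ toℚ d ℚ.+ toℚ (c ℤ.- (d ℤ.- b)) ℚ.* 1/[1+ n ]
toℚ-AP-term≡harmonic-term b c d n = ≡.sym (begin
  toℚ d ℚ.+ toℚ r ℚ.* 1/[1+ n ]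
    ≡⟨ a+q·u≈[n·a+q]·u ℚ-commutativeSemiring {toℚ (+ suc n)} (toℚ d) (toℚ r) (toℚ-[1+n]*1/[1+n]≡1 n) ⟩
  (toℚ (+ suc n) ℚ.* toℚ d ℚ.+ toℚ r) ℚ.* 1/[1+ n ]
    ≡⟨ cong (λ z → (z ℚ.+ toℚ r) ℚ.* 1/[1+ n ]) (toℚ-homo-* (+ suc n) d) ⟨
  (toℚ (+ suc n ℤ.* d) ℚ.+ toℚ r) ℚ.* 1/[1+ n ]
    ≡⟨ cong (ℚ._* 1/[1+ n ]) (toℚ-homo-+ (+ suc n ℤ.* d) r) ⟨
  toℚ (+ suc n ℤ.* d ℤ.+ r) ℚ.* 1/[1+ n ]
    ≡⟨ cong (λ z → toℚ z ℚ.* 1/[1+ n ]) (identity (+ n) b c d) ⟩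
  toℚ ((b ℤ.+ + n ℤ.* d) ℤ.+ c) ℚ.* 1/[1+ n ] ∎)
  where
  open ≡-Reasoning
  r : ℤ
  r = c ℤ.- (d ℤ.- b)
  identity : ∀ m b c d → (+ 1 ℤ.+ m) ℤ.* d ℤ.+ (c ℤ.- (d ℤ.- b)) ≡ (b ℤ.+ m ℤ.* d) ℤ.+ c
  identity = solve-∀

[1+n]·y≡y₀+n·e : ∀ {y₀ y e q} n →
  toℚ y₀ ≡ toℚ e ℚ.+ q ℚ.* 1/[1+ 0 ] → toℚ y ≡ toℚ e ℚ.+ q ℚ.* 1/[1+ n ] →
  + suc n ℤ.* y ≡ y₀ ℤ.+ + n ℤ.* e
[1+n]·y≡y₀+n·e {y₀} {y} {e} {q} n y₀≡e+q/1 y≡e+q/[1+n] = toℚ-injective (begin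
  toℚ (+ suc n ℤ.* y)                               ≡⟨ toℚ-homo-* (+ suc n) y ⟩
  toℚ (+ suc n) ℚ.* toℚ y                           ≡⟨ cong (toℚ (+ suc n) ℚ.*_) y≡e+q/[1+n] ⟩
  toℚ (+ suc n) ℚ.* (toℚ e ℚ.+ q ℚ.* 1/[1+ n ])
    ≡⟨ n·[a+q·u]≈n·a+q ℚ-commutativeSemiring {toℚ (+ suc n)} (toℚ e) q (toℚ-[1+n]*1/[1+n]≡1 n) ⟩
  toℚ (+ suc n) ℚ.* toℚ e ℚ.+ q
    ≡⟨ cong (λ m → m ℚ.* toℚ e ℚ.+ q) (toℚ-homo-+ (+ 1) (+ n)) ⟩
  (1ℚ ℚ.+ toℚ (+ n)) ℚ.* toℚ e ℚ.+ q
    ≡⟨ identity (toℚ (+ n)) (toℚ e) q ⟩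
  (toℚ e ℚ.+ q) ℚ.+ toℚ (+ n) ℚ.* toℚ e
    ≡⟨ cong (λ z → (toℚ e ℚ.+ z) ℚ.+ toℚ (+ n) ℚ.* toℚ e) (ℚP.*-identityʳ q) ⟨
  (toℚ e ℚ.+ q ℚ.* 1/[1+ 0 ]) ℚ.+ toℚ (+ n) ℚ.* toℚ e
    ≡⟨ cong₂ ℚ._+_ (≡.sym y₀≡e+q/1) (≡.sym (toℚ-homo-* (+ n) e)) ⟩
  toℚ y₀ ℚ.+ toℚ (+ n ℤ.* e)
    ≡⟨ toℚ-homo-+ y₀ (+ n ℤ.* e) ⟨
  toℚ (y₀ ℤ.+ + n ℤ.* e)
    ∎)
  where
  open ≡-Reasoning
  open +-*-Solver
  identity : ∀ m e q → (1ℚ ℚ.+ m) ℚ.* e ℚ.+ q ≡ (e ℚ.+ q) ℚ.+ m ℚ.* e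
  identity = solve 3 (λ m e q → (con 1ℚ :+ m) :* e :+ q := (e :+ q) :+ m :* e) refl

FAdmissible⇒GAdmissible : ∀ {k N f} → FAdmissible (suc k) N f →
  ∃ λ m → GAdmissible (suc k) N m × m ≤ suc k * f
-- The differences need not be nonzero: r ≠ 0 comes from the choice of c alone.
FAdmissible⇒GAdmissible {k} (T , _ , refl , D , uD , lD , _ , aps) =
  length S , (S , image-unique ℚP._≟_ point T , refl , D , uD , lD , All.tabulate hasPattern) ,
  length-image ℚP._≟_ point T
  where
  differences : List ℤ
  differences = cartesianProductWith ℤ._-_ D T

  c : ℤ
  c = proj₁ (∃-∉ differences)

  point : ℤ → Fin (suc k) → ℚ
  point t i = toℚ (t ℤ.+ c) ℚ.* 1/[1+ toℕ i ]

  S : List ℚ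
  S = image ℚP._≟_ point T

  hasPattern : ∀ {d} → d ∈ D → HasHarmonicPattern (suc k) S d
  hasPattern {d} d∈D with All.lookup aps d∈D
  ... | b , ap = toℚ r , r≢0 , λ i →
    subst (_∈ S) (toℚ-AP-term≡harmonic-term b c d (toℕ i)) (∈-image ℚP._≟_ point (ap i) i)
    where
    r : ℤ
    r = c ℤ.- (d ℤ.- b)

    b∈T : b ∈ T
    b∈T = subst (_∈ T) (≡.trans (cong (λ z → b ℤ.+ z) (ℤP.*-zeroˡ d)) (ℤP.+-identityʳ b)) (ap Fin.zero)

    r≢0 : toℚ r ≢ 0ℚ
    r≢0 r≡0 = proj₂ (∃-∉ differences) (subst (_∈ differences) c≡d-b d-b∈differences)
      where
      c≡d-b = ≡.sym (ℤP.i-j≡0⇒i≡j c (d ℤ.- b) (toℚ-injective r≡0))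
      d-b∈differences = ∈-cartesianProductWith⁺ ℤ._-_ d∈D b∈T

commonDenominator : List ℚ → ℕ
commonDenominator S = product (map ℚ.↧ₙ_ S)

commonDenominator≢0 : ∀ S → NonZero (commonDenominator S)
commonDenominator≢0 S = product≢0 (AllP.map⁺ (All.universal (λ _ → _) S))

↧∣commonDenominator : ∀ {x S} → x ∈ S → ℚ.↧ₙ x ∣ commonDenominator S
↧∣commonDenominator x∈S = ∈⇒∣product (∈-map⁺ ℚ.↧ₙ_ x∈S)

toℚ-clearDenominator-shift : ∀ {L} a c r u → ℚ.↧ₙ (toℚ a ℚ.+ r ℚ.* u) ∣ L →
  toℚ (clearDenominator L (toℚ a ℚ.+ r ℚ.* u) ℤ.+ + L ℤ.* c) ≡
  toℚ (+ L ℤ.* (a ℤ.+ c)) ℚ.+ (toℚ (+ L) ℚ.* r) ℚ.* u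
toℚ-clearDenominator-shift {L} a c r u ↧∣L = begin
  toℚ (clearDenominator L x ℤ.+ + L ℤ.* c)
    ≡⟨ toℚ-homo-+ (clearDenominator L x) (+ L ℤ.* c) ⟩
  toℚ (clearDenominator L x) ℚ.+ toℚ (+ L ℤ.* c)
    ≡⟨ cong₂ ℚ._+_ (toℚ-clearDenominator x ↧∣L) (toℚ-homo-* (+ L) c) ⟩
  ℓ ℚ.* (toℚ a ℚ.+ r ℚ.* u) ℚ.+ ℓ ℚ.* toℚ c
    ≡⟨ identity ℓ (toℚ a) (toℚ c) r u ⟩
  ℓ ℚ.* (toℚ a ℚ.+ toℚ c) ℚ.+ (ℓ ℚ.* r) ℚ.* u
    ≡⟨ cong (λ z → ℓ ℚ.* z ℚ.+ (ℓ ℚ.* r) ℚ.* u) (toℚ-homo-+ a c) ⟨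
  ℓ ℚ.* toℚ (a ℤ.+ c) ℚ.+ (ℓ ℚ.* r) ℚ.* u
    ≡⟨ cong (ℚ._+ (ℓ ℚ.* r) ℚ.* u) (toℚ-homo-* (+ L) (a ℤ.+ c)) ⟨
  toℚ (+ L ℤ.* (a ℤ.+ c)) ℚ.+ (ℓ ℚ.* r) ℚ.* u
    ∎
  where
  open ≡-Reasoning
  open +-*-Solver
  x = toℚ a ℚ.+ r ℚ.* u
  ℓ = toℚ (+ L)
  identity : ∀ ℓ a c r u → ℓ ℚ.* (a ℚ.+ r ℚ.* u) ℚ.+ ℓ ℚ.* c ≡ ℓ ℚ.* (a ℚ.+ c) ℚ.+ (ℓ ℚ.* r) ℚ.* u
  identity = solve 5 (λ ℓ a c r u → ℓ :* (a :+ r :* u) :+ ℓ :* c := ℓ :* (a :+ c) :+ (ℓ :* r) :* u) refl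

n*[a+c]≢0 : ∀ n .{{_ : NonZero n}} {a c} → c ≢ ℤ.- a → + n ℤ.* (a ℤ.+ c) ≢ 0ℤ
n*[a+c]≢0 n {a} {c} c≢-a n*[a+c]≡0 with ℤP.i*j≡0⇒i≡0∨j≡0 (+ n) n*[a+c]≡0
... | inj₁ n≡0   = ℕ.≢-nonZero⁻¹ n (cong ℤ.∣_∣ n≡0)
... | inj₂ a+c≡0 = c≢-a (begin
  c                    ≡⟨ identity a c ⟩
  ℤ.- a ℤ.+ (a ℤ.+ c)  ≡⟨ cong (λ z → ℤ.- a ℤ.+ z) a+c≡0 ⟩
  ℤ.- a ℤ.+ 0ℤ         ≡⟨ ℤP.+-identityʳ (ℤ.- a) ⟩
  ℤ.- a                ∎)
  where
  open ≡-Reasoning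
  identity : ∀ a c → c ≡ ℤ.- a ℤ.+ (a ℤ.+ c)
  identity = solve-∀

GAdmissible⇒FAdmissible : ∀ {k N g} → GAdmissible (suc k) N g →
  ∃ λ m → FAdmissible (suc k) N m × m ≤ suc k * g
GAdmissible⇒FAdmissible {k} {N} (S , _ , refl , A , uA , lA , pats) =
  length T , (T , image-unique ℤ._≟_ point S , refl , D , uD , lD , AllP.map⁺ (All.tabulate δ≢0) ,
              AllP.map⁺ (All.tabulate hasAP)) ,
  length-image ℤ._≟_ point S
  where
  L : ℕ
  L = commonDenominator S

  instance
    L≢0 : NonZero L
    L≢0 = commonDenominator≢0 S

  negatives : List ℤ
  negatives = map ℤ.-_ A

  c : ℤ
  c = proj₁ (∃-∉ negatives)

  lift : ℚ → ℤ
  lift x = clearDenominator L x ℤ.+ + L ℤ.* c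

  point : ℚ → Fin (suc k) → ℤ
  point x i = + suc (toℕ i) ℤ.* lift x

  T : List ℤ
  T = image ℤ._≟_ point S

  δ : ℤ → ℤ
  δ a = + L ℤ.* (a ℤ.+ c)

  D : List ℤ
  D = map δ A

  uD : Unique D
  uD = UniqueP.map⁺ (λ {a} {a′} eq → +-cancelʳ c a a′ (ℤP.*-cancelˡ-≡ (+ L) (a ℤ.+ c) (a′ ℤ.+ c) eq)) uA

  lD : length D ≡ N
  lD = ≡.trans (ListP.length-map δ A) lA

  δ≢0 : ∀ {a} → a ∈ A → δ a ≢ 0ℤ
  δ≢0 a∈A = n*[a+c]≢0 L λ c≡-a → proj₂ (∃-∉ negatives) (subst (_∈ negatives) (≡.sym c≡-a) (∈-map⁺ ℤ.-_ a∈A))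

  hasAP : ∀ {a} → a ∈ A → HasAP (suc k) T (δ a)
  hasAP {a} a∈A with All.lookup pats a∈A
  ... | r , _ , x∈S = y Fin.zero , λ j → subst (_∈ T) (AP-term j) (∈-image ℤ._≟_ point (x∈S j) j)
    where
    y : Fin (suc k) → ℤ
    y i = lift (toℚ a ℚ.+ r ℚ.* 1/[1+ toℕ i ])

    toℚ-y : ∀ i → toℚ (y i) ≡ toℚ (δ a) ℚ.+ (toℚ (+ L) ℚ.* r) ℚ.* 1/[1+ toℕ i ]
    toℚ-y i = toℚ-clearDenominator-shift a c r 1/[1+ toℕ i ] (↧∣commonDenominator {S = S} (x∈S i))

    AP-term : ∀ j → + suc (toℕ j) ℤ.* y j ≡ y Fin.zero ℤ.+ + toℕ j ℤ.* δ a
    AP-term j = [1+n]·y≡y₀+n·e {y Fin.zero} {y j} {δ a} {toℚ (+ L) ℚ.* r} (toℕ j) (toℚ-y Fin.zero) (toℚ-y j)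

IsLeast⇒≤ : ∀ {P : ℕ → Set} {m b} → IsLeast P m → ∃ (λ m′ → P m′ × m′ ≤ b) → m ≤ b
IsLeast⇒≤ (_ , least) (m′ , Pm′ , m′≤b) = ℕP.≤-trans (least m′ Pm′) m′≤b

mainTheorem7 : (k N : ℕ) → .{{_ : NonZero k}} → .{{_ : NonZero N}} →
    (g f : ℕ) → IsG' k N g → IsF' k N f →
    (g ≤ k * f) × (f ≤ k * g)
mainTheorem7 zero    _ {{k≢0}} _ _ _ _ = ⊥-elim (ℕ.≢-nonZero⁻¹ 0 {{k≢0}} refl)
mainTheorem7 (suc k) N g f g-least f-least =
  IsLeast⇒≤ g-least (FAdmissible⇒GAdmissible (proj₁ f-least)) ,
  IsLeast⇒≤ f-least (GAdmissible⇒FAdmissible (proj₁ g-least))
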